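{- Let $L_5=\{ -3,-2,-1,0,1\}$ with its natural order. Define games over $L_5$: $\star=\{ -1\mid -3\}$, and for a game $G$: $M(G)=\{1\mid G\}$, $P(G)=\{G\mid -2\}$, $P_\star(G)=\{G\mid \star\}$; for $n\in\mathbb{N}$ let $P_n(G)=P(G)$ if $n$ is odd and $P_n(G)=P_\star(G)$ if $n$ is even. Define $G_0=0$ (the atomic game $[0]$) and $G_{n+1}=M(P_n(G_n))$. Then for all $n\in\mathbb{N}$, $G_n$ is monotone.
   Context: Games over a poset $A$ (whose elements are called atoms) are defined inductively: for each $a\in A$, $[a]$ is a game (atomic game, often written simply $a$); and whenever $L$ and $R$ are non-empty sets of games, $\{L\mid R\}$ is a game, whose elements of $L$ (resp. $R$) are its left options $G^L$ (resp. right options $G^R$); $\{G_1,\dots\mid H_1,\dots\}$ denotes the game with those left and right options. A position of $G$ is $G$ itself or, recursively, a position of an option of $G$. Relations $\leq$ and $\lhd$ are defined by mutual recursion: $G\leq H$ iff (1) every left option $G^L$ satisfies $G^L\lhd H$, (2) every right option $H^R$ satisfies $G\lhd H^R$, and (3) if $G$ or $H$ is atomic then $G\lhd H$. And $G\lhd H$ iff at least one of: (1) some right option $G^R$ satisfies $G^R\leq H$, (2) some left option $H^L$ satisfies $G\leq H^L$, (3) $G=[a]$, $H=[b]$ are atomic with $a\leq b$. A game $G$ is locally monotone if every left option satisfies $G\leq G^L$ and every right option satisfies $G^R\leq G$; it is monotone if every position of $G$ is locally monotone. -}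

module Defs where

open import Level using (Level; _⊔_)
open import Data.Nat using (ℕ; zero; suc)
open import Data.Fin using (Fin; zero; suc)
open import Data.Fin.Properties using (≤-poset)
open import Data.Product using (Σ; _×_; _,_)
open import Data.Sum using (_⊎_)
open import Data.Unit.Polymorphic using (⊤)
open import Relation.Binary.Bundles using (Poset)

module GamesOver {c ℓ₁ ℓ₂ : Level} (P : Poset c ℓ₁ ℓ₂) where
  open Poset P renaming (Carrier to A; _≤_ to _≤A_)

  data Game : Set c where
    [_]  : A → Game
    opts : (m n : ℕ) → (Fin (suc m) → Game) → (Fin (suc n) → Game) → Game

  ⟨_∣_⟩ : Game → Game → Game
  ⟨ G ∣ H ⟩ = opts 0 0 (λ _ → G) (λ _ → H)

  infix 4 _≤G_ _⊲_

  mutual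
    -- G ≤ H : (1) every G^L ⊲ H, (2) every H^R has G ⊲ H^R,
    --         (3) if G or H is atomic then G ⊲ H.
    -- (conditions on options of atomic games are vacuous)
    _≤G_ : Game → Game → Set ℓ₂
    [ a ] ≤G [ b ] = [ a ] ⊲ [ b ]
    [ a ] ≤G opts m n L R = (∀ j → [ a ] ⊲ R j) × ([ a ] ⊲ opts m n L R)
    opts m n L R ≤G [ b ] = (∀ i → L i ⊲ [ b ]) × (opts m n L R ⊲ [ b ])
    opts m n L R ≤G opts m' n' L' R' =
      (∀ i → L i ⊲ opts m' n' L' R') × (∀ j → opts m n L R ⊲ R' j)

    _⊲_ : Game → Game → Set ℓ₂
    [ a ] ⊲ [ b ] = a ≤A b
    [ a ] ⊲ opts m n L R = Σ (Fin (suc m)) λ i → [ a ] ≤G L i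
    opts m n L R ⊲ [ b ] = Σ (Fin (suc n)) λ j → R j ≤G [ b ]
    opts m n L R ⊲ opts m' n' L' R' =
      (Σ (Fin (suc n)) λ j → R j ≤G opts m' n' L' R')
      ⊎ (Σ (Fin (suc m')) λ i → opts m n L R ≤G L' i)

  LocallyMonotone : Game → Set ℓ₂
  LocallyMonotone [ a ] = ⊤
  LocallyMonotone (opts m n L R) =
    (∀ i → opts m n L R ≤G L i) × (∀ j → R j ≤G opts m n L R)

  Monotone : Game → Set ℓ₂
  Monotone [ a ] = ⊤
  Monotone (opts m n L R) =
    LocallyMonotone (opts m n L R) × (∀ i → Monotone (L i)) × (∀ j → Monotone (R j))

-- L₅ = {-3,-2,-1,0,1} with its natural order, realised as Fin 5 with
-- -3 ↦ 0, -2 ↦ 1, -1 ↦ 2, 0 ↦ 3, 1 ↦ 4 (an order isomorphism).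

L₅ : Poset _ _ _
L₅ = ≤-poset 5

open GamesOver L₅ public

a-3 a-2 a-1 a0 a1 : Fin 5
a-3 = zero
a-2 = suc zero
a-1 = suc (suc zero)
a0  = suc (suc (suc zero))
a1  = suc (suc (suc (suc zero)))

⋆ : Game
⋆ = ⟨ [ a-1 ] ∣ [ a-3 ] ⟩

M : Game → Game
M G = ⟨ [ a1 ] ∣ G ⟩

P : Game → Game
P G = ⟨ G ∣ [ a-2 ] ⟩

P⋆ : Game → Game
P⋆ G = ⟨ G ∣ ⋆ ⟩

Pₙ : ℕ → Game → Game
Pₙ zero = P⋆
Pₙ (suc zero) = P
Pₙ (suc (suc n)) = Pₙ n

Gₙ : ℕ → Game
Gₙ zero = [ a0 ]
Gₙ (suc n) = M (Pₙ n (Gₙ n))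

{-# OPTIONS --safe #-}
-- Write Hₙ = Pₙ(Gₙ) = {Gₙ | Tₙ} with tail Tₙ ∈ {-2, ⋆}, so that Gₙ₊₁ = {1 | Hₙ}.
-- By induction a ≤ Gₙ ≤ 1 for every atom a ≤ 0. As -2 ≤ Gₙ and -1 ≤ Gₙ, every
-- tail lies below every Hₘ, so any game whose right option is a tail is ⊲ Hₘ.
-- These facts are precisely the local monotonicity conditions Gₙ₊₁ ≤ 1,
-- Hₙ ≤ Gₙ₊₁, Hₙ ≤ Gₙ and Tₙ ≤ Hₙ.
module Submission where

open import Defs
open import Data.Nat using (ℕ; zero; suc; z≤n; s≤s)
open import Data.Nat.Properties using (≤-refl; ≤-trans)
open import Data.Fin using (Fin) renaming (_≤_ to _≤ᶠ_)
open import Data.Product using (_,_; proj₂)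
open import Data.Sum using (inj₁; inj₂)
open import Data.Unit.Polymorphic using (tt)

≤-left⇒⊲ : ∀ K G H → K ≤G G → K ⊲ ⟨ G ∣ H ⟩
≤-left⇒⊲ [ _ ]          G H K≤G = Fin.zero , K≤G
≤-left⇒⊲ (opts _ _ _ _) G H K≤G = inj₂ (Fin.zero , K≤G)

right-≤⇒⊲ : ∀ G H K → H ≤G K → ⟨ G ∣ H ⟩ ⊲ K
right-≤⇒⊲ G H [ _ ]          H≤K = Fin.zero , H≤K
right-≤⇒⊲ G H (opts _ _ _ _) H≤K = inj₁ (Fin.zero , H≤K)

≤-atom⇒⊲ : ∀ G {b} → G ≤G [ b ] → G ⊲ [ b ]
≤-atom⇒⊲ [ _ ]          G≤b = G≤b
≤-atom⇒⊲ (opts _ _ _ _) G≤b = proj₂ G≤b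

data Tail : Game → Set where
  -2-tail : Tail [ a-2 ]
  ⋆-tail  : Tail ⋆

Pₙ-elim : ∀ (Q : Game → Set) n G →
          (∀ {T} → Tail T → Q ⟨ G ∣ T ⟩) → Q (Pₙ n G)
Pₙ-elim Q zero          G q = q ⋆-tail
Pₙ-elim Q (suc zero)    G q = q -2-tail
Pₙ-elim Q (suc (suc n)) G q = Pₙ-elim Q n G q

Hₙ : ℕ → Game
Hₙ n = Pₙ n (Gₙ n)

a-3≤ᶠa-2 : a-3 ≤ᶠ a-2
a-3≤ᶠa-2 = z≤n

a-2≤ᶠa-1 : a-2 ≤ᶠ a-1
a-2≤ᶠa-1 = s≤s z≤n

a-1≤ᶠa0 : a-1 ≤ᶠ a0
a-1≤ᶠa0 = s≤s (s≤s z≤n)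

a0≤ᶠa1 : a0 ≤ᶠ a1
a0≤ᶠa1 = s≤s (s≤s (s≤s z≤n))

-3≤⋆ : [ a-3 ] ≤G ⋆
-3≤⋆ = (λ _ → z≤n) , ≤-left⇒⊲ [ a-3 ] [ a-1 ] [ a-3 ] z≤n

⋆≤atom : ∀ b → a-1 ≤ᶠ b → ⋆ ≤G [ b ]
⋆≤atom b -1≤b = (λ _ → -1≤b) , right-≤⇒⊲ [ a-1 ] [ a-3 ] [ b ] z≤n

tail≤atom : ∀ {T b} → a-1 ≤ᶠ b → Tail T → T ≤G [ b ]
tail≤atom -1≤b -2-tail = ≤-trans a-2≤ᶠa-1 -1≤b
tail≤atom -1≤b ⋆-tail  = ⋆≤atom _ -1≤b

-2⊲tail : ∀ {T} → Tail T → [ a-2 ] ⊲ T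
-2⊲tail -2-tail = ≤-refl
-2⊲tail ⋆-tail  = ≤-left⇒⊲ [ a-2 ] [ a-1 ] [ a-3 ] a-2≤ᶠa-1

⋆⊲tail : ∀ {T} → Tail T → ⋆ ⊲ T
⋆⊲tail -2-tail = right-≤⇒⊲ [ a-1 ] [ a-3 ] [ a-2 ] a-3≤ᶠa-2
⋆⊲tail ⋆-tail  = right-≤⇒⊲ [ a-1 ] [ a-3 ] ⋆ -3≤⋆

tail≤⟨∣tail⟩ : ∀ G {T T′} → [ a-2 ] ≤G G → [ a-1 ] ≤G G →
               Tail T → Tail T′ → T ≤G ⟨ G ∣ T′ ⟩
tail≤⟨∣tail⟩ G {T′ = T′} -2≤G -1≤G -2-tail t′ =
  (λ _ → -2⊲tail t′) , ≤-left⇒⊲ [ a-2 ] G T′ -2≤G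
tail≤⟨∣tail⟩ G {T′ = T′} -2≤G -1≤G ⋆-tail  t′ =
  (λ _ → ≤-left⇒⊲ [ a-1 ] G T′ -1≤G) , (λ _ → ⋆⊲tail t′)

tail-monotone : ∀ {T} → Tail T → Monotone T
tail-monotone -2-tail = tt
tail-monotone ⋆-tail  =
  ((λ _ → ⋆≤atom a-1 ≤-refl) , (λ _ → -3≤⋆)) , (λ _ → tt) , (λ _ → tt)

Gₙ≤1 : ∀ n → Gₙ n ≤G [ a1 ]
Gₙ≤1 zero    = a0≤ᶠa1
Gₙ≤1 (suc n) = (λ _ → ≤-refl) , right-≤⇒⊲ [ a1 ] (Hₙ n) [ a1 ] Hₙ≤1
  where
  Hₙ≤1 : Hₙ n ≤G [ a1 ]
  Hₙ≤1 = Pₙ-elim (_≤G [ a1 ]) n (Gₙ n) λ {T} t →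
    (λ _ → ≤-atom⇒⊲ (Gₙ n) (Gₙ≤1 n)) ,
    right-≤⇒⊲ (Gₙ n) T [ a1 ] (tail≤atom (≤-trans a-1≤ᶠa0 a0≤ᶠa1) t)

atom≤Gₙ : ∀ a → a ≤ᶠ a0 → ∀ n → [ a ] ≤G Gₙ n
atom≤Gₙ a a≤0 zero    = a≤0
atom≤Gₙ a a≤0 (suc n) =
  (λ _ → a⊲Hₙ) , ≤-left⇒⊲ [ a ] [ a1 ] (Hₙ n) (≤-trans a≤0 a0≤ᶠa1)
  where
  a⊲Hₙ : [ a ] ⊲ Hₙ n
  a⊲Hₙ = Pₙ-elim ([ a ] ⊲_) n (Gₙ n) λ {T} _ →
    ≤-left⇒⊲ [ a ] (Gₙ n) T (atom≤Gₙ a a≤0 n)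

tail≤⟨Gₙ∣tail⟩ : ∀ {T T′} n → Tail T → Tail T′ → T ≤G ⟨ Gₙ n ∣ T′ ⟩
tail≤⟨Gₙ∣tail⟩ n = tail≤⟨∣tail⟩ (Gₙ n)
  (atom≤Gₙ a-2 (≤-trans a-2≤ᶠa-1 a-1≤ᶠa0) n) (atom≤Gₙ a-1 a-1≤ᶠa0 n)

tail≤Hₙ : ∀ {T} n → Tail T → T ≤G Hₙ n
tail≤Hₙ {T} n t = Pₙ-elim (T ≤G_) n (Gₙ n) (tail≤⟨Gₙ∣tail⟩ n t)

⟨∣tail⟩⊲Hₙ : ∀ {X T} n → Tail T → ⟨ X ∣ T ⟩ ⊲ Hₙ n
⟨∣tail⟩⊲Hₙ {X} {T} n t = right-≤⇒⊲ X T (Hₙ n) (tail≤Hₙ n t)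

Hₙ≤Gₙ : ∀ n → Hₙ n ≤G Gₙ n
Hₙ≤Gₙ zero    = (λ _ → ≤-refl) , right-≤⇒⊲ [ a0 ] ⋆ [ a0 ] (⋆≤atom a0 a-1≤ᶠa0)
Hₙ≤Gₙ (suc n) = Pₙ-elim (_≤G Gₙ (suc n)) (suc n) (Gₙ (suc n)) λ t →
  (λ _ → ≤-left⇒⊲ (Gₙ (suc n)) [ a1 ] (Hₙ n) (Gₙ≤1 (suc n))) ,
  (λ _ → ⟨∣tail⟩⊲Hₙ n t)

Hₙ≤Gₙ₊₁ : ∀ n → Hₙ n ≤G Gₙ (suc n)
Hₙ≤Gₙ₊₁ n = Pₙ-elim (_≤G Gₙ (suc n)) n (Gₙ n) λ t →
  (λ _ → ≤-left⇒⊲ (Gₙ n) [ a1 ] (Hₙ n) (Gₙ≤1 n)) , (λ _ → ⟨∣tail⟩⊲Hₙ n t)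

Hₙ-monotone : ∀ n → Monotone (Gₙ n) → Monotone (Hₙ n)
Hₙ-monotone n Gₙ-mono = Pₙ-elim (λ H → H ≤G Gₙ n → Monotone H) n (Gₙ n)
  (λ t H≤Gₙ → ((λ _ → H≤Gₙ) , (λ _ → tail≤⟨Gₙ∣tail⟩ n t t)) ,
               (λ _ → Gₙ-mono) , (λ _ → tail-monotone t))
  (Hₙ≤Gₙ n)

lemma1 : (n : ℕ) → Monotone (Gₙ n)
lemma1 zero    = tt
lemma1 (suc n) =
  ((λ _ → Gₙ≤1 (suc n)) , (λ _ → Hₙ≤Gₙ₊₁ n)) ,
  (λ _ → tt) , (λ _ → Hₙ-monotone n (lemma1 n))
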